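{- Let $N\ge 2$, $r\ge 2$, let $e_0,\dots,e_{r-1}$ be distinct real numbers and ${\bf k}=(k_0,\dots,k_{r-1})$ non-negative integers with $\sum_m k_m=N$. Let $g$ be a non-zero real function on $\{e_0,\dots,e_{r-1}\}$ with $\sum_{m=0}^{r-1}k_m g(e_m)=0$, fix $1\le \ell\le N$, and define $f$ on $\mathcal V_{N,{\bf k}}$ by $f(x)=g(x_\ell)$. Then $L_{\mathcal G_{N,{\bf k}}}f(x)=Nf(x)$ for all $x\in\mathcal V_{N,{\bf k}}$.
   Context: $\mathcal V_{N,{\bf k}}$ is the set of $N$-tuples $x=(x_1,\dots,x_N)\in\{e_0,\dots,e_{r-1}\}^N$ in which exactly $k_m$ entries equal $e_m$ for each $m$. For $i<j$, $\pi_{i,j}x$ swaps entries $i$ and $j$ of $x$. The graph $\mathcal G_{N,{\bf k}}$ has vertex set $\mathcal V_{N,{\bf k}}$ with distinct $x,y$ adjacent iff $y=\pi_{i,j}x$ for some $i<j$, and $L_{\mathcal G_{N,{\bf k}}}f(x)=\sum_{y\text{ adjacent to }x}(f(x)-f(y))$. -}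

module Defs where

open import Level using (Level)
open import Data.Nat as ℕ using (ℕ; zero; suc; _≡ᵇ_; _<ᵇ_)
open import Data.Fin using (Fin; toℕ; _≟_)
open import Data.Fin.Base using () renaming (zero to fzero; suc to fsuc)
open import Data.Bool using (Bool; true; false; if_then_else_; _∧_; not)
open import Data.List using (List; []; _∷_; map; concatMap; foldr; filterᵇ; allFin)
open import Data.Bool.ListAction using (any; all)
open import Data.Vec using (Vec; []; _∷_; lookup; tabulate)
open import Data.Vec.Properties using (≡-dec)
open import Relation.Nullary.Decidable using (⌊_⌋)
open import Relation.Binary.PropositionalEquality using (_≡_)
open import Algebra.Bundles using (CommutativeRing)

sumℕ : {r : ℕ} → (Fin r → ℕ) → ℕ
sumℕ {zero}  k = 0
sumℕ {suc r} k = k fzero ℕ.+ sumℕ (λ m → k (fsuc m))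

count : {N r : ℕ} → Fin r → Vec (Fin r) N → ℕ
count m []       = 0
count m (a ∷ xs) = (if ⌊ a ≟ m ⌋ then 1 else 0) ℕ.+ count m xs

-- Membership in V_{N,k} (labels e_m represented by m : Fin r).
_∈V_ : {N r : ℕ} → Vec (Fin r) N → (Fin r → ℕ) → Set
x ∈V k = ∀ m → count m x ≡ k m

inVᵇ : {N r : ℕ} → (Fin r → ℕ) → Vec (Fin r) N → Bool
inVᵇ {r = r} k x = all (λ m → count m x ≡ᵇ k m) (allFin r)

swap : {N r : ℕ} → Fin N → Fin N → Vec (Fin r) N → Vec (Fin r) N
swap i j x = tabulate λ t →
  lookup x (if ⌊ t ≟ i ⌋ then j else (if ⌊ t ≟ j ⌋ then i else t))

allVecs : (N r : ℕ) → List (Vec (Fin r) N)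
allVecs zero    r = [] ∷ []
allVecs (suc N) r = concatMap (λ a → map (a ∷_) (allVecs N r)) (allFin r)

adjᵇ : {N r : ℕ} → (Fin r → ℕ) → Vec (Fin r) N → Vec (Fin r) N → Bool
adjᵇ {N} k x y =
  inVᵇ k x ∧ inVᵇ k y ∧ not ⌊ ≡-dec _≟_ x y ⌋ ∧
  any (λ i → any (λ j → (toℕ i <ᵇ toℕ j) ∧ ⌊ ≡-dec _≟_ y (swap i j x) ⌋)
                 (allFin N))
      (allFin N)

neighbours : {N r : ℕ} → (Fin r → ℕ) → Vec (Fin r) N → List (Vec (Fin r) N)
neighbours {N} {r} k x = filterᵇ (adjᵇ k x) (allVecs N r)

module _ {c ℓ : Level} (R : CommutativeRing c ℓ) where
  open CommutativeRing R

  _·_ : ℕ → Carrier → Carrier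
  zero  · a = 0#
  suc n · a = a + (n · a)

  sumR : {r : ℕ} → (Fin r → Carrier) → Carrier
  sumR {zero}  h = 0#
  sumR {suc r} h = h fzero + sumR (λ m → h (fsuc m))

  laplacian : {N r : ℕ} → (Fin r → ℕ) → (Vec (Fin r) N → Carrier) → Vec (Fin r) N → Carrier
  laplacian k f x = foldr _+_ 0# (map (λ y → f x - f y) (neighbours k x))

-- A neighbour y of x contributes f(x) − f(y), which vanishes unless y_ℓ ≠ x_ℓ;
-- those neighbours are exactly the transpositions π_{ℓ,j} x with x_j ≠ x_ℓ, one for each such j.
-- Hence L f (x) = Σ_j (g(x_ℓ) − g(x_j)) = N g(x_ℓ) − Σ_m k_m g(e_m), and the last sum is 0.
module Submission where

open import Level using (Level)
open import Algebra.Bundles using (CommutativeMonoid; CommutativeRing)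
open import Data.Bool using (Bool; true; false; T; if_then_else_; _∧_; not)
open import Data.Bool.Properties using (T-∧)
open import Data.Bool.ListAction using (any)
open import Data.Empty using (⊥-elim)
open import Data.Fin using (Fin; zero; suc; toℕ; _≟_; _<_)
open import Data.Fin.Permutation using () renaming (transpose to transposition)
open import Data.Fin.Permutation.Components using (transpose)
open import Data.Fin.Properties using (<-cmp; any?; suc-injective; 0≢1+n)
open import Data.List using (List; []; _∷_; _++_; map; foldr; filterᵇ; concatMap; allFin; tabulate)
open import Data.List.Membership.Propositional using (lose)
open import Data.List.Membership.Propositional.Properties using (∈-allFin)
open import Data.List.Properties using (map-∘)
import Data.List.Relation.Unary.All as All
open import Data.List.Relation.Unary.All.Properties using (all⁻)
open import Data.List.Relation.Unary.Any using (satisfied)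
open import Data.List.Relation.Unary.Any.Properties using (any⁺; any⁻)
open import Data.Nat as ℕ using (ℕ; _≤_; _<ᵇ_)
open import Data.Nat.Properties using (≡⇒≡ᵇ; <⇒<ᵇ; +-0-commutativeMonoid)
open import Data.Product using (∃; ∃₂; _,_; proj₂)
open import Data.Vec as Vec using (Vec; []; _∷_; lookup)
open import Data.Vec.Properties using (≡-dec; lookup∘tabulate; tabulate-cong)
open import Function using (_∘_; Equivalence)
open import Relation.Binary.Definitions using (DecidableEquality; Tri; tri<; tri≈; tri>)
open import Relation.Binary.PropositionalEquality using (_≡_; _≢_; refl; sym; trans; cong; cong₂; module ≡-Reasoning)
open import Relation.Nullary using (¬_; Dec; yes; no; does)
open import Relation.Nullary.Decidable using (⌊_⌋; fromWitness; toWitness; fromWitnessFalse)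
open import Relation.Unary using (Decidable)
import Algebra.Properties.CommutativeMonoid.Sum +-0-commutativeMonoid as ℕ-Sum

open import Defs

_≟ⱽ_ : ∀ {r N} → DecidableEquality (Vec (Fin r) N)
_≟ⱽ_ = ≡-dec _≟_

transpose-matchˡ : ∀ {n} (i j : Fin n) → transpose i j i ≡ j
transpose-matchˡ i j with i ≟ i
... | yes _   = refl
... | no i≢i = ⊥-elim (i≢i refl)

transpose-matchʳ : ∀ {n} (i j : Fin n) → transpose i j j ≡ i
transpose-matchʳ i j with j ≟ i
... | yes j≡i = j≡i
... | no _ with j ≟ j
...   | yes _   = refl
...   | no j≢j = ⊥-elim (j≢j refl)

transpose-fixed : ∀ {n} (i j : Fin n) {t} → t ≢ i → t ≢ j → transpose i j t ≡ t
transpose-fixed i j {t} t≢i t≢j with t ≟ i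
... | yes t≡i = ⊥-elim (t≢i t≡i)
... | no _ with t ≟ j
...   | yes t≡j = ⊥-elim (t≢j t≡j)
...   | no _    = refl

transpose-comm : ∀ {n} (i j t : Fin n) → transpose i j t ≡ transpose j i t
transpose-comm i j t = by-cases (t ≟ i) (t ≟ j)
  where
  by-cases : Dec (t ≡ i) → Dec (t ≡ j) → transpose i j t ≡ transpose j i t
  by-cases (yes refl) _          = trans (transpose-matchˡ t j) (sym (transpose-matchʳ j t))
  by-cases (no _)     (yes refl) = trans (transpose-matchʳ i t) (sym (transpose-matchˡ t i))
  by-cases (no t≢i)   (no t≢j)   = trans (transpose-fixed i j t≢i t≢j) (sym (transpose-fixed j i t≢j t≢i))

count≡∑ : ∀ {n r} (m : Fin r) (x : Vec (Fin r) n) →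
          count m x ≡ ℕ-Sum.sum (λ t → if ⌊ lookup x t ≟ m ⌋ then 1 else 0)
count≡∑ m []      = refl
count≡∑ m (a ∷ x) = cong (_ ℕ.+_) (count≡∑ m x)

module _ {N r : ℕ} where

  swap-transpose : ∀ (i j : Fin N) (x : Vec (Fin r) N) → swap i j x ≡ Vec.tabulate (lookup x ∘ transpose i j)
  swap-transpose i j x = tabulate-cong (cong (lookup x) ∘ index≡transpose)
    where
    index≡transpose : ∀ t → (if ⌊ t ≟ i ⌋ then j else (if ⌊ t ≟ j ⌋ then i else t)) ≡ transpose i j t
    index≡transpose t with t ≟ i
    ... | yes _ = refl
    ... | no _ with t ≟ j
    ...   | yes _ = refl
    ...   | no _  = refl

  lookup-swap : ∀ (i j : Fin N) (x : Vec (Fin r) N) t → lookup (swap i j x) t ≡ lookup x (transpose i j t)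
  lookup-swap i j x t = trans (cong (λ v → lookup v t) (swap-transpose i j x)) (lookup∘tabulate _ t)

  swap-lookupˡ : ∀ (i j : Fin N) (x : Vec (Fin r) N) → lookup (swap i j x) i ≡ lookup x j
  swap-lookupˡ i j x = trans (lookup-swap i j x i) (cong (lookup x) (transpose-matchˡ i j))

  swap-lookupʳ : ∀ (i j : Fin N) (x : Vec (Fin r) N) → lookup (swap i j x) j ≡ lookup x i
  swap-lookupʳ i j x = trans (lookup-swap i j x j) (cong (lookup x) (transpose-matchʳ i j))

  swap-lookup-fixed : ∀ {i j t : Fin N} (x : Vec (Fin r) N) → t ≢ i → t ≢ j → lookup (swap i j x) t ≡ lookup x t
  swap-lookup-fixed {i} {j} {t} x t≢i t≢j = trans (lookup-swap i j x t) (cong (lookup x) (transpose-fixed i j t≢i t≢j))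

  swap-comm : ∀ (i j : Fin N) (x : Vec (Fin r) N) → swap i j x ≡ swap j i x
  swap-comm i j x = begin
    swap i j x                               ≡⟨ swap-transpose i j x ⟩
    Vec.tabulate (lookup x ∘ transpose i j)  ≡⟨ tabulate-cong (cong (lookup x) ∘ transpose-comm i j) ⟩
    Vec.tabulate (lookup x ∘ transpose j i)  ≡⟨ sym (swap-transpose j i x) ⟩
    swap j i x                               ∎
    where open ≡-Reasoning

  count-swap : ∀ (i j : Fin N) (m : Fin r) (x : Vec (Fin r) N) → count m (swap i j x) ≡ count m x
  count-swap i j m x = begin
    count m (swap i j x)                               ≡⟨ count≡∑ m (swap i j x) ⟩
    ℕ-Sum.sum (λ t → δ (lookup (swap i j x) t))         ≡⟨ ℕ-Sum.sum-cong-≗ (cong δ ∘ lookup-swap i j x) ⟩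
    ℕ-Sum.sum (λ t → δ (lookup x (transpose i j t)))   ≡⟨ sym (ℕ-Sum.∑-permute (δ ∘ lookup x) (transposition i j)) ⟩
    ℕ-Sum.sum (λ t → δ (lookup x t))                   ≡⟨ sym (count≡∑ m x) ⟩
    count m x                                          ∎
    where
    open ≡-Reasoning
    δ : Fin r → ℕ
    δ a = if ⌊ a ≟ m ⌋ then 1 else 0

  swap-∈V : ∀ (i j : Fin N) (x : Vec (Fin r) N) {k : Fin r → ℕ} → x ∈V k → swap i j x ∈V k
  swap-∈V i j x x∈V m = trans (count-swap i j m x) (x∈V m)

  swap-moves : ∀ {i j ℓ : Fin N} {x y : Vec (Fin r) N} → y ≡ swap i j x → lookup y ℓ ≢ lookup x ℓ →
               ∃ λ j′ → y ≡ swap ℓ j′ x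
  swap-moves {i} {j} {ℓ} {x} refl moved with ℓ ≟ i | ℓ ≟ j
  ... | yes refl | _        = j , refl
  ... | no _     | yes refl = i , swap-comm i ℓ x
  ... | no ℓ≢i   | no ℓ≢j   = ⊥-elim (moved (swap-lookup-fixed x ℓ≢i ℓ≢j))

  swapˡ-injective : ∀ {ℓ j j′ : Fin N} (x : Vec (Fin r) N) → lookup x j ≢ lookup x ℓ →
                    swap ℓ j′ x ≡ swap ℓ j x → j′ ≡ j
  swapˡ-injective {ℓ} {j} {j′} x xⱼ≢xₗ eq with j′ ≟ j
  ... | yes j′≡j = j′≡j
  ... | no j′≢j  = ⊥-elim (xⱼ≢xₗ (begin
    lookup x j              ≡⟨ sym (swap-lookup-fixed x j≢ℓ (j′≢j ∘ sym)) ⟩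
    lookup (swap ℓ j′ x) j  ≡⟨ cong (λ v → lookup v j) eq ⟩
    lookup (swap ℓ j x) j   ≡⟨ swap-lookupʳ ℓ j x ⟩
    lookup x ℓ              ∎))
    where
    open ≡-Reasoning
    j≢ℓ : j ≢ ℓ
    j≢ℓ refl = xⱼ≢xₗ refl

T-∧⁺ : ∀ {a b} → T a → T b → T (a ∧ b)
T-∧⁺ ta tb = Equivalence.from T-∧ (ta , tb)

T-∧ʳ : ∀ a {b} → T (a ∧ b) → T b
T-∧ʳ a = proj₂ ∘ Equivalence.to (T-∧ {a})

module _ {N r : ℕ} {k : Fin r → ℕ} where

  ∈V⇒inVᵇ : ∀ (x : Vec (Fin r) N) → x ∈V k → T (inVᵇ k x)
  ∈V⇒inVᵇ x x∈V = all⁻ _ (All.universal (λ m → ≡⇒≡ᵇ (count m x) (k m) (x∈V m)) (allFin r))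

  transposesᵇ : Vec (Fin r) N → Vec (Fin r) N → Fin N → Fin N → Bool
  transposesᵇ x y i j = (toℕ i <ᵇ toℕ j) ∧ ⌊ y ≟ⱽ swap i j x ⌋

  transposedᵇ : Vec (Fin r) N → Vec (Fin r) N → Bool
  transposedᵇ x y = any (λ i → any (transposesᵇ x y i) (allFin N)) (allFin N)

  adjᵇ⇒transposedᵇ : ∀ {x y : Vec (Fin r) N} → T (adjᵇ k x y) → T (transposedᵇ x y)
  adjᵇ⇒transposedᵇ {x} {y} = T-∧ʳ (not ⌊ x ≟ⱽ y ⌋) ∘ T-∧ʳ (inVᵇ k y) ∘ T-∧ʳ (inVᵇ k x)

  adjᵇ⇒swap : ∀ {x y : Vec (Fin r) N} → T (adjᵇ k x y) → ∃₂ λ i j → y ≡ swap i j x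
  adjᵇ⇒swap {x} {y} adj
    with i , some-j ← satisfied (any⁻ _ (allFin N) (adjᵇ⇒transposedᵇ adj))
    with j , i<j∧y≡swap ← satisfied (any⁻ (transposesᵇ x y i) (allFin N) some-j)
    = i , j , toWitness (T-∧ʳ (toℕ i <ᵇ toℕ j) i<j∧y≡swap)

  swap⇒adjᵇ : ∀ {ℓ j : Fin N} {x : Vec (Fin r) N} → x ∈V k → lookup x j ≢ lookup x ℓ →
              T (adjᵇ k x (swap ℓ j x))
  swap⇒adjᵇ {ℓ} {j} {x} x∈V xⱼ≢xₗ =
    T-∧⁺ (∈V⇒inVᵇ x x∈V) (T-∧⁺ (∈V⇒inVᵇ y (swap-∈V ℓ j x x∈V)) (T-∧⁺ (fromWitnessFalse x≢y) (ordered (<-cmp ℓ j))))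
    where
    y : Vec (Fin r) N
    y = swap ℓ j x
    x≢y : x ≢ y
    x≢y x≡y = xⱼ≢xₗ (sym (trans (cong (λ v → lookup v ℓ) x≡y) (swap-lookupˡ ℓ j x)))
    transposed : ∀ {i j′} → i < j′ → y ≡ swap i j′ x → T (transposedᵇ x y)
    transposed {i} {j′} i<j′ y≡swap =
      any⁺ _ (lose (∈-allFin i) (any⁺ _ (lose (∈-allFin j′) (T-∧⁺ (<⇒<ᵇ i<j′) (fromWitness y≡swap)))))
    ordered : Tri (ℓ < j) (ℓ ≡ j) (j < ℓ) → T (transposedᵇ x y)
    ordered (tri< ℓ<j _ _) = transposed ℓ<j refl
    ordered (tri≈ _ ℓ≡j _) = ⊥-elim (xⱼ≢xₗ (cong (lookup x) (sym ℓ≡j)))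
    ordered (tri> _ _ j<ℓ) = transposed j<ℓ (swap-comm ℓ j x)

module Sums {c ℓ} (M : CommutativeMonoid c ℓ) where
  open CommutativeMonoid M renaming
    ( _∙_ to _+_; ε to 0#; ∙-cong to +-cong; ∙-congˡ to +-congˡ; ∙-congʳ to +-congʳ
    ; identityˡ to +-identityˡ; identityʳ to +-identityʳ; assoc to +-assoc
    ; refl to ≈-refl; sym to ≈-sym; trans to ≈-trans )
  open import Algebra.Properties.CommutativeMonoid.Sum M using (sum-syntax; sum-cong-≋; sum-replicate-zero; ∑-distrib-+)
  open import Algebra.Properties.Monoid.Mult monoid using (_×_; ×-homo-+)
  open import Relation.Binary.Reasoning.Setoid setoid

  infixr 8 [_]·_
  [_]·_ : Bool → Carrier → Carrier
  [ b ]· a = if b then a else 0#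

  []·-T : ∀ {b} a → T b → [ b ]· a ≡ a
  []·-T {true} a _ = refl

  []·-¬T : ∀ {b} a → ¬ T b → [ b ]· a ≡ 0#
  []·-¬T {true}  a ¬t = ⊥-elim (¬t _)
  []·-¬T {false} a ¬t = refl

  []·-no : ∀ {p} {A : Set p} (A? : Dec A) a → ¬ A → [ does A? ]· a ≈ 0#
  []·-no (yes x) a ¬x = ⊥-elim (¬x x)
  []·-no (no _)  a ¬x = ≈-refl

  []·-0# : ∀ b {a} → a ≈ 0# → [ b ]· a ≈ 0#
  []·-0# true  a≈0 = a≈0
  []·-0# false a≈0 = ≈-refl

  []·-∧ : ∀ p q a → [ p ∧ q ]· a ≡ [ p ]· [ q ]· a
  []·-∧ true  q a = refl
  []·-∧ false q a = refl

  ∑-zero : ∀ {n} (h : Fin n → Carrier) → (∀ i → h i ≈ 0#) → ∑[ i < n ] h i ≈ 0#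
  ∑-zero {n} h h≈0 = ≈-trans (sum-cong-≋ h≈0) (sum-replicate-zero n)

  ∑-unique : ∀ {n} {P : Fin n → Set} (P? : Decidable P) → (∀ {i j} → P i → P j → i ≡ j) →
             ∀ {i} → P i → (h : Fin n → Carrier) → ∑[ j < n ] ([ does (P? j) ]· h j) ≈ h i
  ∑-unique {ℕ.suc n} P? unique {zero} p₀ h with P? zero
  ... | yes _  = ≈-trans (+-congˡ (∑-zero _ λ j → []·-no (P? (suc j)) _ (0≢1+n ∘ unique p₀))) (+-identityʳ _)
  ... | no ¬p₀ = ⊥-elim (¬p₀ p₀)
  ∑-unique {ℕ.suc n} P? unique {suc i} pᵢ h with P? zero
  ... | yes p₀ = ⊥-elim (0≢1+n (unique p₀ pᵢ))
  ... | no _   = ≈-trans (+-identityˡ _) (∑-unique (P? ∘ suc) (λ p q → suc-injective (unique p q)) pᵢ (h ∘ suc))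

  ∑-δ : ∀ {n} (i : Fin n) (h : Fin n → Carrier) → ∑[ j < n ] ([ does (j ≟ i) ]· h j) ≈ h i
  ∑-δ i = ∑-unique (_≟ i) (λ p q → trans p (sym q)) refl

  listSum : {A : Set} → (A → Carrier) → List A → Carrier
  listSum h xs = foldr _+_ 0# (map h xs)

  listSum-cong : ∀ {A : Set} {h h′ : A → Carrier} → (∀ y → h y ≈ h′ y) → ∀ xs → listSum h xs ≈ listSum h′ xs
  listSum-cong h≈h′ []       = ≈-refl
  listSum-cong h≈h′ (y ∷ xs) = +-cong (h≈h′ y) (listSum-cong h≈h′ xs)

  listSum-zero : ∀ {A : Set} (h : A → Carrier) → (∀ y → h y ≈ 0#) → ∀ xs → listSum h xs ≈ 0#
  listSum-zero h h≈0 []       = ≈-refl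
  listSum-zero h h≈0 (y ∷ xs) = ≈-trans (+-cong (h≈0 y) (listSum-zero h h≈0 xs)) (+-identityʳ 0#)

  listSum-++ : ∀ {A : Set} (h : A → Carrier) xs ys → listSum h (xs ++ ys) ≈ listSum h xs + listSum h ys
  listSum-++ h []       ys = ≈-sym (+-identityˡ _)
  listSum-++ h (y ∷ xs) ys = ≈-trans (+-congˡ (listSum-++ h xs ys)) (≈-sym (+-assoc _ _ _))

  listSum-map : ∀ {A B : Set} (h : B → Carrier) (f : A → B) xs → listSum h (map f xs) ≡ listSum (h ∘ f) xs
  listSum-map h f xs = cong (foldr _+_ 0#) (sym (map-∘ xs))

  listSum-concatMap : ∀ {A B : Set} (h : B → Carrier) (f : A → List B) xs →
                      listSum h (concatMap f xs) ≈ listSum (listSum h ∘ f) xs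
  listSum-concatMap h f []       = ≈-refl
  listSum-concatMap h f (y ∷ xs) = ≈-trans (listSum-++ h (f y) (concatMap f xs)) (+-congˡ (listSum-concatMap h f xs))

  listSum-tabulate : ∀ {n} {A : Set} (h : A → Carrier) (f : Fin n → A) → listSum h (tabulate f) ≈ ∑[ i < n ] h (f i)
  listSum-tabulate {ℕ.zero}  h f = ≈-refl
  listSum-tabulate {ℕ.suc n} h f = +-congˡ (listSum-tabulate h (f ∘ suc))

  listSum-filterᵇ : ∀ {A : Set} (p : A → Bool) (h : A → Carrier) xs →
                    listSum h (filterᵇ p xs) ≈ listSum (λ y → [ p y ]· h y) xs
  listSum-filterᵇ p h []       = ≈-refl
  listSum-filterᵇ p h (y ∷ xs) with p y
  ... | true  = +-congˡ (listSum-filterᵇ p h xs)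
  ... | false = ≈-trans (listSum-filterᵇ p h xs) (≈-sym (+-identityˡ _))

  listSum-[]· : ∀ {A : Set} b (h : A → Carrier) xs → listSum (λ y → [ b ]· h y) xs ≈ [ b ]· listSum h xs
  listSum-[]· true  h xs = ≈-refl
  listSum-[]· false h xs = listSum-zero _ (λ _ → ≈-refl) xs

  listSum-∑ : ∀ {A : Set} {n} (f : A → Fin n → Carrier) xs →
              listSum (λ y → ∑[ j < n ] f y j) xs ≈ ∑[ j < n ] listSum (λ y → f y j) xs
  listSum-∑ {n = n} f [] = ≈-sym (∑-zero {n} _ (λ _ → ≈-refl))
  listSum-∑ f (y ∷ xs) = ≈-trans (+-congˡ (listSum-∑ f xs)) (≈-sym (∑-distrib-+ (f y) _))

  listSum-allVecs : ∀ N r (h : Vec (Fin r) (ℕ.suc N) → Carrier) →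
                    listSum h (allVecs (ℕ.suc N) r) ≈ ∑[ a < r ] listSum (h ∘ (a ∷_)) (allVecs N r)
  listSum-allVecs N r h = begin
    listSum h (allVecs (ℕ.suc N) r)
      ≈⟨ listSum-concatMap h _ (allFin r) ⟩
    listSum (λ a → listSum h (map (a ∷_) (allVecs N r))) (allFin r)
      ≈⟨ listSum-cong (λ a → reflexive (listSum-map h (a ∷_) (allVecs N r))) (allFin r) ⟩
    listSum (λ a → listSum (h ∘ (a ∷_)) (allVecs N r)) (allFin r)
      ≈⟨ listSum-tabulate {r} (λ a → listSum (h ∘ (a ∷_)) (allVecs N r)) (λ a → a) ⟩
    ∑[ a < r ] listSum (h ∘ (a ∷_)) (allVecs N r) ∎

  listSum-allVecs-δ : ∀ {r} N (v : Vec (Fin r) N) (h : Vec (Fin r) N → Carrier) →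
                      listSum (λ y → [ does (y ≟ⱽ v) ]· h y) (allVecs N r) ≈ h v
  listSum-allVecs-δ ℕ.zero    []      h = +-identityʳ (h [])
  listSum-allVecs-δ {r} (ℕ.suc N) (b ∷ v) h = begin
    listSum (λ y → [ does (y ≟ⱽ (b ∷ v)) ]· h y) (allVecs (ℕ.suc N) r)
      -- ≡-dec decides a cons by _×-dec_ on head and tail, so its verdict is a conjunction definitionally.
      ≈⟨ listSum-allVecs N r _ ⟩
    ∑[ a < r ] listSum (λ ys → [ does (a ≟ b) ∧ does (ys ≟ⱽ v) ]· h (a ∷ ys)) (allVecs N r)
      ≈⟨ sum-cong-≋ (λ a → listSum-cong (λ ys → reflexive ([]·-∧ (does (a ≟ b)) _ _)) (allVecs N r)) ⟩
    ∑[ a < r ] listSum (λ ys → [ does (a ≟ b) ]· [ does (ys ≟ⱽ v) ]· h (a ∷ ys)) (allVecs N r)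
      ≈⟨ sum-cong-≋ (λ a → listSum-[]· (does (a ≟ b)) _ (allVecs N r)) ⟩
    ∑[ a < r ] ([ does (a ≟ b) ]· listSum (λ ys → [ does (ys ≟ⱽ v) ]· h (a ∷ ys)) (allVecs N r))
      ≈⟨ ∑-δ b _ ⟩
    listSum (λ ys → [ does (ys ≟ⱽ v) ]· h (b ∷ ys)) (allVecs N r)
      ≈⟨ listSum-allVecs-δ N v (h ∘ (b ∷_)) ⟩
    h (b ∷ v) ∎

  []·-if : ∀ {p} {A : Set p} (A? : Dec A) a → (if ⌊ A? ⌋ then 1 else 0) × a ≈ [ does A? ]· a
  []·-if (yes _) a = +-identityʳ a
  []·-if (no _)  a = ≈-refl

  ∑-lookup≈∑-count : ∀ {N r} (φ : Fin r → Carrier) (x : Vec (Fin r) N) →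
                     ∑[ t < N ] φ (lookup x t) ≈ ∑[ m < r ] (count m x × φ m)
  ∑-lookup≈∑-count {r = r} φ []      = ≈-sym (∑-zero {r} _ (λ _ → ≈-refl))
  ∑-lookup≈∑-count {r = r} φ (a ∷ x) = begin
    φ a + ∑[ t < _ ] φ (lookup x t)
      ≈⟨ +-cong (≈-sym (∑-unique (a ≟_) (λ p q → trans (sym p) q) refl φ)) (∑-lookup≈∑-count φ x) ⟩
    ∑[ m < r ] ([ does (a ≟ m) ]· φ m) + ∑[ m < r ] (count m x × φ m)
      ≈⟨ ∑-distrib-+ (λ m → [ does (a ≟ m) ]· φ m) (λ m → count m x × φ m) ⟨
    ∑[ m < r ] ([ does (a ≟ m) ]· φ m + count m x × φ m)
      ≈⟨ sum-cong-≋ (λ m → ≈-trans (+-congʳ (≈-sym ([]·-if (a ≟ m) (φ m)))) (≈-sym (×-homo-+ (φ m) (if ⌊ a ≟ m ⌋ then 1 else 0) (count m x)))) ⟩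
    ∑[ m < r ] (count m (a ∷ x) × φ m) ∎

module _ {c ℓ′ : Level} (R : CommutativeRing c ℓ′) where
  open CommutativeRing R renaming (refl to ≈-refl; sym to ≈-sym; trans to ≈-trans) hiding (zero)
  open import Algebra.Properties.Ring ring using (-0#≈0#; -‿+-comm)
  open import Algebra.Properties.CommutativeMonoid.Sum +-commutativeMonoid using (sum-syntax; sum-cong-≋; sum-cong-≗; sum-replicate; ∑-distrib-+)
  open import Algebra.Properties.Monoid.Mult +-monoid using (_×_)
  open import Relation.Binary.Reasoning.Setoid setoid
  open Sums +-commutativeMonoid

  ∑-neg : ∀ {n} (h : Fin n → Carrier) → ∑[ i < n ] (- h i) ≈ - ∑[ i < n ] h i
  ∑-neg {ℕ.zero}  h = ≈-sym -0#≈0#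
  ∑-neg {ℕ.suc n} h = ≈-trans (+-congˡ (∑-neg (h ∘ suc))) (-‿+-comm (h zero) _)

  ∑-const-minus : ∀ {n} a (h : Fin n → Carrier) → ∑[ i < n ] (a - h i) ≈ n × a - ∑[ i < n ] h i
  ∑-const-minus {n} a h = ≈-trans (∑-distrib-+ (λ _ → a) (λ i → - h i)) (+-cong (sum-replicate n) (∑-neg h))

  ·≡× : ∀ n a → _·_ R n a ≡ n × a
  ·≡× ℕ.zero    a = refl
  ·≡× (ℕ.suc n) a = cong (a +_) (·≡× n a)

  sumR≡∑ : ∀ {r} (h : Fin r → Carrier) → sumR R h ≡ ∑[ m < r ] h m
  sumR≡∑ {ℕ.zero}  h = refl
  sumR≡∑ {ℕ.suc r} h = cong (h zero +_) (sumR≡∑ (h ∘ suc))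

  module _ {N r : ℕ} (k : Fin r → ℕ) (φ : Fin r → Carrier) (ℓ : Fin N) {x : Vec (Fin r) N} (x∈V : x ∈V k) where

    private
      Δ : Vec (Fin r) N → Carrier
      Δ y = φ (lookup x ℓ) - φ (lookup y ℓ)

    adjᵇ-as-swaps : ∀ y → [ adjᵇ k x y ]· Δ y ≈ ∑[ j < N ] ([ does (y ≟ⱽ swap ℓ j x) ]· Δ y)
    adjᵇ-as-swaps y with lookup y ℓ ≟ lookup x ℓ
    ... | yes same = ≈-trans ([]·-0# (adjᵇ k x y) Δy≈0) (≈-sym (∑-zero {N} _ (λ j → []·-0# _ Δy≈0)))
      where
      Δy≈0 : Δ y ≈ 0#
      Δy≈0 = ≈-trans (+-congˡ (-‿cong (reflexive (cong φ same)))) (-‿inverseʳ _)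
    ... | no moved with any? (λ j → y ≟ⱽ swap ℓ j x)
    ...   | yes (j , refl) = begin
      [ adjᵇ k x (swap ℓ j x) ]· Δ (swap ℓ j x)
        ≡⟨ []·-T _ (swap⇒adjᵇ {ℓ = ℓ} {j} x∈V xⱼ≢xₗ) ⟩
      Δ (swap ℓ j x)
        ≈⟨ ∑-unique (λ j′ → swap ℓ j x ≟ⱽ swap ℓ j′ x) unique refl (λ _ → Δ (swap ℓ j x)) ⟨
      ∑[ j′ < N ] ([ does (swap ℓ j x ≟ⱽ swap ℓ j′ x) ]· Δ (swap ℓ j x)) ∎
      where
      xⱼ≢xₗ : lookup x j ≢ lookup x ℓ
      xⱼ≢xₗ = moved ∘ trans (swap-lookupˡ ℓ j x)
      unique : ∀ {i i′} → swap ℓ j x ≡ swap ℓ i x → swap ℓ j x ≡ swap ℓ i′ x → i ≡ i′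
      unique p q = trans (swapˡ-injective x xⱼ≢xₗ (sym p)) (sym (swapˡ-injective x xⱼ≢xₗ (sym q)))
    ...   | no none = ≈-trans (reflexive ([]·-¬T _ not-adjacent))
                        (≈-sym (∑-zero _ (λ j → []·-no (y ≟ⱽ swap ℓ j x) _ (λ eq → none (j , eq)))))
      where
      not-adjacent : ¬ T (adjᵇ k x y)
      not-adjacent adj with i , j , y≡swap ← adjᵇ⇒swap adj = none (swap-moves {i = i} {j} {x = x} y≡swap moved)

    laplacian-coordinate : laplacian R k (λ y → φ (lookup y ℓ)) x ≈ ∑[ j < N ] (φ (lookup x ℓ) - φ (lookup x j))
    laplacian-coordinate = begin
      laplacian R k (λ y → φ (lookup y ℓ)) x
        ≈⟨ listSum-filterᵇ (adjᵇ k x) Δ (allVecs N r) ⟩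
      listSum (λ y → [ adjᵇ k x y ]· Δ y) (allVecs N r)
        ≈⟨ listSum-cong adjᵇ-as-swaps (allVecs N r) ⟩
      listSum (λ y → ∑[ j < N ] ([ does (y ≟ⱽ swap ℓ j x) ]· Δ y)) (allVecs N r)
        ≈⟨ listSum-∑ (λ y j → [ does (y ≟ⱽ swap ℓ j x) ]· Δ y) (allVecs N r) ⟩
      ∑[ j < N ] listSum (λ y → [ does (y ≟ⱽ swap ℓ j x) ]· Δ y) (allVecs N r)
        ≈⟨ sum-cong-≋ (λ j → listSum-allVecs-δ N (swap ℓ j x) Δ) ⟩
      ∑[ j < N ] Δ (swap ℓ j x)
        ≡⟨ sum-cong-≗ (λ j → cong (λ a → φ (lookup x ℓ) - φ a) (swap-lookupˡ ℓ j x)) ⟩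
      ∑[ j < N ] (φ (lookup x ℓ) - φ (lookup x j)) ∎

lemma2p1 : {c ℓ' : Level} (R : CommutativeRing c ℓ') (N r : ℕ) → 2 ≤ N → 2 ≤ r →
    (k : Fin r → ℕ) → sumℕ k ≡ N →
    (g : Fin r → CommutativeRing.Carrier R) →
    (∃ λ m → ¬ CommutativeRing._≈_ R (g m) (CommutativeRing.0# R)) →
    CommutativeRing._≈_ R (sumR R (λ m → _·_ R (k m) (g m))) (CommutativeRing.0# R) →
    (ℓ : Fin N) → (x : Vec (Fin r) N) → x ∈V k →
    CommutativeRing._≈_ R
      (laplacian R k (λ y → g (lookup y ℓ)) x)
      (_·_ R N (g (lookup x ℓ)))
lemma2p1 R N r _ _ k _ g _ ∑kg≈0 ℓ x x∈V = begin
  laplacian R k (λ y → g (lookup y ℓ)) x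
    ≈⟨ laplacian-coordinate R k g ℓ x∈V ⟩
  ∑[ j < N ] (gₗ - g (lookup x j))
    ≈⟨ ∑-const-minus R gₗ (g ∘ lookup x) ⟩
  N × gₗ - ∑[ j < N ] g (lookup x j)
    ≈⟨ +-congˡ (-‿cong (∑-lookup≈∑-count g x)) ⟩
  N × gₗ - ∑[ m < r ] (count m x × g m)
    ≡⟨ cong₂ _-_ (sym (·≡× R N gₗ)) (sum-cong-≗ (λ m → trans (cong (_× g m) (x∈V m)) (sym (·≡× R (k m) (g m))))) ⟩
  _·_ R N gₗ - ∑[ m < r ] _·_ R (k m) (g m)
    ≈⟨ +-congˡ (-‿cong (≈-trans (reflexive (sym (sumR≡∑ R {r} _))) ∑kg≈0)) ⟩
  _·_ R N gₗ - 0#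
    ≈⟨ ≈-trans (+-congˡ -0#≈0#) (+-identityʳ _) ⟩
  _·_ R N gₗ ∎
  where
  open CommutativeRing R renaming (refl to ≈-refl; sym to ≈-sym; trans to ≈-trans) hiding (zero)
  open import Algebra.Properties.Ring ring using (-0#≈0#)
  open import Algebra.Properties.CommutativeMonoid.Sum +-commutativeMonoid using (sum-syntax; sum-cong-≗)
  open Sums +-commutativeMonoid using (∑-lookup≈∑-count)
  open import Algebra.Properties.Monoid.Mult +-monoid using (_×_)
  open import Relation.Binary.Reasoning.Setoid setoid
  gₗ : Carrier
  gₗ = g (lookup x ℓ)
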